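{- Let $A$ be an srl-monoid, $H$ a convex subalgebra of $A$ and $a,b\in A$. The following are equivalent: a) $(a,b)\in \theta_H$; b) $(a\rightarrow b)\wedge e\in H$ and $(b\rightarrow a)\wedge e\in H$; c) $s(a,b)\in H$; d) there exists $h\in H$ such that $h\leq a\rightarrow b$ and $h\leq b\rightarrow a$.
   Context: A commutative l-monoid is an algebra $(A,\wedge,\vee,\cdot,e)$ of type $(2,2,2,0)$ such that $(A,\wedge,\vee)$ is a lattice, $(A,\cdot,e)$ is a commutative monoid and $(a\vee b)\cdot c=(a\cdot c)\vee(b\cdot c)$ for all $a,b,c\in A$. An algebra $(A,\wedge,\vee,\cdot,\rightarrow,e)$ of type $(2,2,2,2,0)$ is an srl-monoid if $(A,\wedge,\vee,\cdot,e)$ is a commutative l-monoid and there is a subalgebra $Q$ of $(A,\wedge,\vee,\cdot,e)$ such that for all $a,b\in A$ the set $\{q\in Q: a\cdot q\leq b\}$ has a maximum and $a\rightarrow b$ equals this maximum. A convex subalgebra of $A$ is a subalgebra $H$ of $(A,\wedge,\vee,\cdot,\rightarrow,e)$ such that whenever $a,b\in H$, $c\in A$ and $a\le c\le b$, then $c\in H$. For such $H$, $\theta_H=\{(a,b)\in A\times A: a\cdot h\leq b \text{ and } b\cdot h\leq a \text{ for some } h\in H\}$. Also $s(a,b)=(a\rightarrow b)\wedge(b\rightarrow a)\wedge e$. -}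

module Defs where

open import Level using (Level; suc; _⊔_)
open import Data.Product using (Σ; _×_; _,_; ∃)
open import Relation.Binary.PropositionalEquality using (_≡_)
open import Algebra.Core using (Op₂)
open import Algebra.Structures using (IsCommutativeMonoid)
open import Algebra.Lattice.Structures using (IsLattice)

record CommLMonoid (c : Level) : Set (suc c) where
  infixr 7 _·_
  infixr 6 _∧_
  infixr 5 _∨_
  infix 4 _≤_
  field
    Carrier : Set c
    _∧_ _∨_ _·_ : Op₂ Carrier
    e : Carrier
    isLattice : IsLattice _≡_ _∨_ _∧_
    isCommutativeMonoid : IsCommutativeMonoid _≡_ _·_ e
    ·-distribʳ-∨ : ∀ a b c → (a ∨ b) · c ≡ (a · c) ∨ (b · c)

  _≤_ : Carrier → Carrier → Set c
  a ≤ b = (a ∧ b) ≡ a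

-- srl-monoid: a commutative l-monoid with an operation ⇒ and some
-- subalgebra Q of (A,∧,∨,·,e) such that a ⇒ b = max {q ∈ Q : a·q ≤ b}.
record SrlMonoid (c q : Level) : Set (suc (c ⊔ q)) where
  field
    lmonoid : CommLMonoid c
  open CommLMonoid lmonoid public
  infixr 4 _⇒_
  field
    _⇒_ : Op₂ Carrier
    Q : Carrier → Set q
    Q-∧ : ∀ {a b} → Q a → Q b → Q (a ∧ b)
    Q-∨ : ∀ {a b} → Q a → Q b → Q (a ∨ b)
    Q-· : ∀ {a b} → Q a → Q b → Q (a · b)
    Q-e : Q e
    ⇒-inQ : ∀ a b → Q (a ⇒ b)
    ⇒-below : ∀ a b → a · (a ⇒ b) ≤ b
    ⇒-max : ∀ a b x → Q x → a · x ≤ b → x ≤ (a ⇒ b)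

module _ {c q : Level} (A : SrlMonoid c q) where
  open SrlMonoid A

  record IsConvexSubalgebra {h : Level} (H : Carrier → Set h) : Set (c ⊔ h) where
    field
      H-∧ : ∀ {a b} → H a → H b → H (a ∧ b)
      H-∨ : ∀ {a b} → H a → H b → H (a ∨ b)
      H-· : ∀ {a b} → H a → H b → H (a · b)
      H-⇒ : ∀ {a b} → H a → H b → H (a ⇒ b)
      H-e : H e
      H-convex : ∀ {a b x} → H a → H b → a ≤ x → x ≤ b → H x

  θ : {h : Level} (H : Carrier → Set h) → Carrier → Carrier → Set (c ⊔ h)
  θ H a b = Σ Carrier λ k → H k × (a · k ≤ b) × (b · k ≤ a)

  s : Carrier → Carrier → Carrier
  s a b = (a ⇒ b) ∧ (b ⇒ a) ∧ e

{-# OPTIONS --safe #-}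
module Submission where

-- All four conditions are equivalent to (d): some k ∈ H lies below both a ⇒ b
-- and b ⇒ a.  A witness k of θ_H yields e ⇒ k ∈ H, which lies in Q and below k,
-- hence below both residuals by their maximality; conversely k ≤ x ⇒ y gives
-- x · k ≤ y.  Convexity between k ∧ e ∈ H and e ∈ H moves membership in H from
-- a lower bound k up to (a ⇒ b) ∧ e, (b ⇒ a) ∧ e and s(a, b).

open import Defs
open import Level using (Level; _⊔_)
open import Data.Product using (Σ; _×_; _,_)
open import Function.Bundles using (_⇔_; mk⇔)
import Function.Properties.Equivalence as ⇔
open import Relation.Binary.PropositionalEquality using (_≡_; sym; trans; cong; subst; subst₂)
open import Algebra.Lattice.Bundles using (Lattice)
open import Algebra.Lattice.Structures using (IsLattice)
open import Algebra.Lattice.Properties.Lattice using (∨-∧-orderTheoreticLattice)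
import Relation.Binary.Lattice as Order
open import Algebra.Structures using (IsCommutativeMonoid)

module CommLMonoidProperties {c : Level} (M : CommLMonoid c) where
  open CommLMonoid M
  open IsCommutativeMonoid isCommutativeMonoid using (comm)

  private
    lattice : Lattice c c
    lattice = record { isLattice = isLattice }

    -- The library orders a lattice by  x ≈ x ∧ y,  the mirror image of  _≤_.
    open Order.Lattice (∨-∧-orderTheoreticLattice lattice)
      using (antisym; x≤x∨y; y≤x∨y; ∨-least)
      renaming (_≤_ to _≼_; refl to ≼-refl; trans to ≼-trans;
                x∧y≤x to x∧y≼x; x∧y≤y to x∧y≼y; ∧-greatest to ∧-greatest′)

  ≤-trans : ∀ {x y z} → x ≤ y → y ≤ z → x ≤ z
  ≤-trans x≤y y≤z = sym (≼-trans (sym x≤y) (sym y≤z))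

  x∧y≤x : ∀ x y → x ∧ y ≤ x
  x∧y≤x x y = sym (x∧y≼x x y)

  x∧y≤y : ∀ x y → x ∧ y ≤ y
  x∧y≤y x y = sym (x∧y≼y x y)

  ∧-greatest : ∀ {x y z} → x ≤ y → x ≤ z → x ≤ y ∧ z
  ∧-greatest x≤y x≤z = sym (∧-greatest′ (sym x≤y) (sym x≤z))

  ≤⇒∨≡ : ∀ {x y} → x ≤ y → x ∨ y ≡ y
  ≤⇒∨≡ x≤y = antisym (∨-least (sym x≤y) ≼-refl) (y≤x∨y _ _)

  ·-monoˡ-≤ : ∀ {x y} k → x ≤ y → x · k ≤ y · k
  ·-monoˡ-≤ {x} {y} k x≤y = sym (subst (x · k ≼_) x·k∨y·k≡y·k (x≤x∨y (x · k) (y · k)))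
    where
    x·k∨y·k≡y·k : x · k ∨ y · k ≡ y · k
    x·k∨y·k≡y·k = trans (sym (·-distribʳ-∨ x y k)) (cong (_· k) (≤⇒∨≡ x≤y))

  ·-monoʳ-≤ : ∀ {x y} k → x ≤ y → k · x ≤ k · y
  ·-monoʳ-≤ {x} {y} k x≤y = subst₂ _≤_ (comm x k) (comm y k) (·-monoˡ-≤ k x≤y)

module SrlMonoidProperties {c q : Level} (A : SrlMonoid c q) where
  open SrlMonoid A
  open CommLMonoidProperties lmonoid public
  open IsCommutativeMonoid isCommutativeMonoid using (identityˡ)

  ≤⇒-elim : ∀ {x y k} → k ≤ (x ⇒ y) → x · k ≤ y
  ≤⇒-elim {x} {y} k≤x⇒y = ≤-trans (·-monoʳ-≤ x k≤x⇒y) (⇒-below x y)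

  e⇒x≤x : ∀ x → (e ⇒ x) ≤ x
  e⇒x≤x x = subst (_≤ x) (identityˡ (e ⇒ x)) (⇒-below e x)

  -- e ⇒ k lies in Q, so it can replace an arbitrary k in the maximality of ⇒.
  e⇒≤⇒ : ∀ {x y k} → x · k ≤ y → (e ⇒ k) ≤ (x ⇒ y)
  e⇒≤⇒ {x} {y} {k} x·k≤y =
    ⇒-max x y (e ⇒ k) (⇒-inQ e k) (≤-trans (·-monoʳ-≤ x (e⇒x≤x k)) x·k≤y)

module ConvexSubalgebraProperties
  {c q h : Level} (A : SrlMonoid c q) {H : SrlMonoid.Carrier A → Set h}
  (isConvex : IsConvexSubalgebra A H) where
  open SrlMonoid A
  open SrlMonoidProperties A
  open IsConvexSubalgebra isConvex
  open IsLattice isLattice using (∧-assoc)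

  H-∧e-upward : ∀ {k x} → H k → k ≤ x → H (x ∧ e)
  H-∧e-upward {k} {x} k∈H k≤x =
    H-convex (H-∧ k∈H H-e) H-e
      (∧-greatest (≤-trans (x∧y≤x k e) k≤x) (x∧y≤y k e)) (x∧y≤y x e)

  module _ (a b : Carrier) where

    CommonLowerBound : Set (c ⊔ h)
    CommonLowerBound = Σ Carrier (λ k → H k × (k ≤ (a ⇒ b)) × (k ≤ (b ⇒ a)))

    θ⇔commonLowerBound : θ A H a b ⇔ CommonLowerBound
    θ⇔commonLowerBound = mk⇔
      (λ (k , k∈H , a·k≤b , b·k≤a) → (e ⇒ k) , H-⇒ H-e k∈H , e⇒≤⇒ a·k≤b , e⇒≤⇒ b·k≤a)
      (λ (k , k∈H , k≤a⇒b , k≤b⇒a) → k , k∈H , ≤⇒-elim k≤a⇒b , ≤⇒-elim k≤b⇒a)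

    commonLowerBound⇔∧e : CommonLowerBound ⇔ (H ((a ⇒ b) ∧ e) × H ((b ⇒ a) ∧ e))
    commonLowerBound⇔∧e = mk⇔
      (λ (k , k∈H , k≤a⇒b , k≤b⇒a) → H-∧e-upward k∈H k≤a⇒b , H-∧e-upward k∈H k≤b⇒a)
      (λ (u∈H , v∈H) → _ , H-∧ u∈H v∈H ,
        ≤-trans (x∧y≤x _ _) (x∧y≤x _ _) , ≤-trans (x∧y≤y _ _) (x∧y≤x _ _))

    commonLowerBound⇔s : CommonLowerBound ⇔ H (s A a b)
    commonLowerBound⇔s = mk⇔
      (λ (k , k∈H , k≤a⇒b , k≤b⇒a) →
        subst H (∧-assoc _ _ _) (H-∧e-upward k∈H (∧-greatest k≤a⇒b k≤b⇒a)))
      (λ s∈H → s A a b , s∈H , x∧y≤x _ _ , ≤-trans (x∧y≤y _ _) (x∧y≤x _ _))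

lemma3p5 : {c q h : Level} (A : SrlMonoid c q) (H : SrlMonoid.Carrier A → Set h)
           → IsConvexSubalgebra A H
           → (a b : SrlMonoid.Carrier A)
           → let open SrlMonoid A in
             (θ A H a b ⇔ (H ((a ⇒ b) ∧ e) × H ((b ⇒ a) ∧ e)))
             × (θ A H a b ⇔ H (s A a b))
             × (θ A H a b ⇔ Σ Carrier (λ k → H k × (k ≤ (a ⇒ b)) × (k ≤ (b ⇒ a))))
lemma3p5 A H isConvex a b =
    ⇔.trans (θ⇔commonLowerBound a b) (commonLowerBound⇔∧e a b)
  , ⇔.trans (θ⇔commonLowerBound a b) (commonLowerBound⇔s a b)
  , θ⇔commonLowerBound a b
  where open ConvexSubalgebraProperties A isConvex
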